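{- For any integer $k\ge 2$ and any prime $p\le k$, $$-2< a_p(k)-\frac{k}{p-1}\le \log_p k .$$
   Context: For a prime $p$ and integer $m$, $\nu_p(m)$ denotes the largest $r$ with $p^r\mid m$, with $\nu_p(0)=\infty$. Let $e_p(k)=\nu_p(k!)$ and, for integers $n$, $f_{p,k}(n)=\sum_{j=0}^{k-1}\nu_p(n-j)$. Define $a_p(k)$ to be the smallest integer $m\ge 0$ such that whether or not $f_{p,k}(n)\ge 2e_p(k)$ holds depends only on the congruence class of $n$ modulo $p^m$. -}

module Defs where

open import Data.Nat as ℕ using (ℕ; zero; suc; _+_; _*_; _≤_; _!)
open import Data.Nat.Divisibility as ℕD using (_∣?_; divides)

open import Data.Integer as ℤ using (ℤ; +_; -[1+_]; ∣_∣; _-_)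
open import Data.Integer.Divisibility as ℤD using ()
open import Data.Product using (_×_)
open import Relation.Nullary using (yes; no)
open import Function.Bundles using (_⇔_)

data ℕ∞ : Set where
  fin : ℕ → ℕ∞
  ∞   : ℕ∞

infixl 6 _⊕_
_⊕_ : ℕ∞ → ℕ∞ → ℕ∞
fin a ⊕ fin b = fin (a + b)
fin _ ⊕ ∞     = ∞
∞     ⊕ _     = ∞

infix 4 _≤∞_
data _≤∞_ : ℕ∞ → ℕ∞ → Set where
  fin≤fin : ∀ {a b} → a ≤ b → fin a ≤∞ fin b
  _≤∞-∞   : ∀ x → x ≤∞ ∞

-- number of times p divides m, using fuel (fuel = m suffices for p ≥ 2, m ≥ 1)
valFuel : ℕ → ℕ → ℕ → ℕ
valFuel zero       p m = zero
valFuel (suc fuel) p m with p ∣? m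
... | yes (divides q _) = suc (valFuel fuel p q)
... | no _              = zero

ν : ℕ → ℤ → ℕ∞
ν p (+ zero)  = ∞
ν p (+ suc n) = fin (valFuel (suc n) p (suc n))
ν p -[1+ n ]  = fin (valFuel (suc n) p (suc n))

e : ℕ → ℕ → ℕ∞
e p k = ν p (+ (k !))

f : ℕ → ℕ → ℤ → ℕ∞
f p zero    n = fin 0
f p (suc k) n = f p k n ⊕ ν p (n - + k)

Cond : ℕ → ℕ → ℤ → Set
Cond p k n = e p k ⊕ e p k ≤∞ f p k n

DependsOnlyMod : ℕ → ℕ → ℕ → Set
DependsOnlyMod p k m =
  ∀ (n n′ : ℤ) → + (p ℕ.^ m) ℤD.∣ (n - n′) → (Cond p k n ⇔ Cond p k n′)

IsA : ℕ → ℕ → ℕ → Set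
IsA p k m = DependsOnlyMod p k m × (∀ m′ → DependsOnlyMod p k m′ → m ≤ m′)

module Submission where

-- Let p be a prime, 2 ≤ k, p ≤ k, L = ⌊log_p k⌋ and E = e_p(k) = ν_p(k!).  We
-- prove a_p(k) = L + E; the two inequalities of the theorem, k < (a + 2)(p - 1)
-- and p ^ (a (p - 1)) ≤ k ^ (p - 1) p ^ k, then follow from Legendre's formula
-- k = (p - 1) E + s_p(k), the base-p digit sum s_p(k) lying in [1, (L + 1)(p - 1)].
--
-- The key device is the truncated sum W k M n = ∑_{j<k} min (M , ν_p(n - j)),
-- which depends only on n modulo p ^ M.  Counting multiples of p, p², … in windows
-- of k consecutive integers gives W k L n ≥ E, with equality on the window
-- -1, …, -k.  Hence f_{p,k}(n) ≥ 2E iff W k (L + E) n ≥ 2E: either some n - j is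
-- divisible by p ^ (L + E) and both hold, or no valuation in the window exceeds
-- L + E and f_{p,k}(n) = W k (L + E) n.  So L + E is a valid modulus, and it is
-- the least one since n = (p^L - 1) - p^(L+E-1) fails the condition while
-- n′ = p^L - 1, congruent to it modulo p^(L+E-1), satisfies it.

open import Defs
open import Data.Nat using (ℕ; _+_; _*_; _∸_; _^_; _≤_; _<_)
open import Data.Nat.Primality using (Prime)
open import Data.Product using (Σ; _×_)

open import Data.Nat using (zero; suc; z≤n; s≤s; NonZero; >-nonZero; _⊓_; _/_; _%_; _!)
open import Data.Nat.Properties
open import Data.Nat.DivMod using (m≡m%n+[m/n]*n; m%n<n; n/1≡n; m/n/o≡m/[n*o]; /-congʳ; m≥n⇒m/n>0; m<n*o⇒m/o<n)
open import Data.Nat.Divisibility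
  using (_∣_; _∣?_; divides; _∣0; ∣-refl; ∣-reflexive; ∣-trans; ∣⇒≤; >⇒∤; n∣m*n; ∣m⇒∣m*n; *-cancelˡ-∣)
open import Data.Nat.Primality using (euclidsLemma; ¬prime[0]; ¬prime[1])
import Data.Nat.Tactic.RingSolver as ℕ-Solver
open import Data.Integer as ℤ using (ℤ; +_; -[1+_]; ∣_∣)
import Data.Integer.Properties as ℤP
import Data.Integer.DivMod as ℤDM
import Data.Integer.Divisibility.Signed as ℤS
import Data.Integer.Tactic.RingSolver as ℤ-Solver
open import Data.Product using (_,_)
open import Data.Sum using (inj₁; inj₂)
open import Data.Empty using (⊥-elim)
open import Relation.Nullary using (¬_; yes; no)
open import Relation.Binary.Definitions using (tri<; tri≈; tri>)
open import Relation.Binary.PropositionalEquality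
open import Function.Bundles using (mk⇔; Equivalence)

∑< : ℕ → (ℕ → ℕ) → ℕ
∑< zero    F = 0
∑< (suc k) F = ∑< k F + F k

syntax ∑< k (λ j → F) = ∑[ j < k ] F

∑-cong : ∀ k {F G : ℕ → ℕ} → (∀ j → j < k → F j ≡ G j) → ∑< k F ≡ ∑< k G
∑-cong zero    F≡G = refl
∑-cong (suc k) F≡G = cong₂ _+_ (∑-cong k (λ j j<k → F≡G j (m<n⇒m<1+n j<k))) (F≡G k ≤-refl)

∑-mono : ∀ k {F G : ℕ → ℕ} → (∀ j → j < k → F j ≤ G j) → ∑< k F ≤ ∑< k G
∑-mono zero    F≤G = z≤n
∑-mono (suc k) F≤G = +-mono-≤ (∑-mono k (λ j j<k → F≤G j (m<n⇒m<1+n j<k))) (F≤G k ≤-refl)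

∑-split : ∀ a b (F : ℕ → ℕ) → ∑< (a + b) F ≡ ∑< a F + ∑[ j < b ] F (a + j)
∑-split a zero    F = trans (cong (λ c → ∑< c F) (+-identityʳ a)) (sym (+-identityʳ (∑< a F)))
∑-split a (suc b) F = begin
  ∑< (a + suc b) F                                    ≡⟨ cong (λ c → ∑< c F) (+-suc a b) ⟩
  ∑< (a + b) F + F (a + b)                            ≡⟨ cong (_+ F (a + b)) (∑-split a b F) ⟩
  ∑< a F + ∑[ j < b ] F (a + j) + F (a + b)           ≡⟨ +-assoc (∑< a F) _ _ ⟩
  ∑< a F + (∑[ j < b ] F (a + j) + F (a + b))         ∎
  where open ≡-Reasoning

∑-distrib-+ : ∀ k (F G : ℕ → ℕ) → ∑[ j < k ] (F j + G j) ≡ ∑< k F + ∑< k G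
∑-distrib-+ zero    F G = refl
∑-distrib-+ (suc k) F G = begin
  ∑[ j < k ] (F j + G j) + (F k + G k)  ≡⟨ cong (_+ (F k + G k)) (∑-distrib-+ k F G) ⟩
  (∑< k F + ∑< k G) + (F k + G k)       ≡⟨ interchange (∑< k F) (∑< k G) (F k) (G k) ⟩
  (∑< k F + F k) + (∑< k G + G k)       ∎
  where
    open ≡-Reasoning
    interchange : ∀ a b c d → (a + b) + (c + d) ≡ (a + c) + (b + d)
    interchange = ℕ-Solver.solve-∀

∑-vanish : ∀ k (F : ℕ → ℕ) → (∀ j → j < k → F j ≡ 0) → ∑< k F ≡ 0
∑-vanish zero    F F≡0 = refl
∑-vanish (suc k) F F≡0 = cong₂ _+_ (∑-vanish k F (λ j j<k → F≡0 j (m<n⇒m<1+n j<k))) (F≡0 k ≤-refl)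

∑-swap : ∀ k l (F : ℕ → ℕ → ℕ) → ∑[ j < k ] ∑[ s < l ] F j s ≡ ∑[ s < l ] ∑[ j < k ] F j s
∑-swap zero    l F = sym (∑-vanish l (λ _ → 0) (λ _ _ → refl))
∑-swap (suc k) l F = begin
  ∑[ j < k ] ∑[ s < l ] F j s + ∑[ s < l ] F k s   ≡⟨ cong (_+ ∑[ s < l ] F k s) (∑-swap k l F) ⟩
  ∑[ s < l ] ∑[ j < k ] F j s + ∑[ s < l ] F k s   ≡⟨ ∑-distrib-+ l (λ s → ∑[ j < k ] F j s) (λ s → F k s) ⟨
  ∑[ s < l ] (∑[ j < k ] F j s + F k s)            ∎
  where open ≡-Reasoning

∑-term : ∀ k (F : ℕ → ℕ) j → j < k → F j ≤ ∑< k F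
∑-term (suc k) F j j<1+k with j ≟ k
... | yes refl = m≤n+m (F k) (∑< k F)
... | no  j≢k  = ≤-trans (∑-term k F j (≤∧≢⇒< (≤-pred j<1+k) j≢k)) (m≤m+n (∑< k F) (F k))

∑-single : ∀ k (F : ℕ → ℕ) j₀ → j₀ < k → (∀ j → j < k → ¬ j ≡ j₀ → F j ≡ 0) → ∑< k F ≡ F j₀
∑-single (suc k) F j₀ j₀<1+k others with j₀ ≟ k
... | yes refl = trans (cong (_+ F k) (∑-vanish k F (λ j j<k → others j (m<n⇒m<1+n j<k) (<⇒≢ j<k))))
                       (+-identityˡ (F k))
... | no  j₀≢k = trans (cong₂ _+_ (∑-single k F j₀ (≤∧≢⇒< (≤-pred j₀<1+k) j₀≢k)
                                     (λ j j<k → others j (m<n⇒m<1+n j<k)))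
                                  (others k ≤-refl (λ k≡j₀ → j₀≢k (sym k≡j₀))))
                       (+-identityʳ (F j₀))

∑-bound : ∀ k (F : ℕ → ℕ) c → (∀ j → j < k → F j ≤ c) → ∑< k F ≤ k * c
∑-bound zero    F c F≤c = z≤n
∑-bound (suc k) F c F≤c = ≤-trans (+-mono-≤ (∑-bound k F c (λ j j<k → F≤c j (m<n⇒m<1+n j<k))) (F≤c k ≤-refl))
                                  (≤-reflexive (+-comm (k * c) c))

∑-ones : ∀ k (F : ℕ → ℕ) → (∀ j → j < k → F j ≡ 1) → ∑< k F ≡ k
∑-ones zero    F F≡1 = refl
∑-ones (suc k) F F≡1 = trans (cong₂ _+_ (∑-ones k F (λ j j<k → F≡1 j (m<n⇒m<1+n j<k))) (F≡1 k ≤-refl))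
                             (+-comm k 1)

∑-threshold : ∀ M V (G : ℕ → ℕ) → (∀ s → s < V → G s ≡ 1) → (∀ s → V ≤ s → G s ≡ 0) →
              ∑< M G ≡ M ⊓ V
∑-threshold zero    V G below above = refl
∑-threshold (suc M) V G below above with M <? V
... | yes M<V = begin
  ∑< M G + G M  ≡⟨ cong₂ _+_ (∑-threshold M V G below above) (below M M<V) ⟩
  M ⊓ V + 1     ≡⟨ cong (_+ 1) (m≤n⇒m⊓n≡m (<⇒≤ M<V)) ⟩
  M + 1         ≡⟨ +-comm M 1 ⟩
  suc M         ≡⟨ m≤n⇒m⊓n≡m M<V ⟨
  suc M ⊓ V     ∎
  where open ≡-Reasoning
... | no M≮V = begin
  ∑< M G + G M  ≡⟨ cong₂ _+_ (∑-threshold M V G below above) (above M (≮⇒≥ M≮V)) ⟩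
  M ⊓ V + 0     ≡⟨ +-identityʳ _ ⟩
  M ⊓ V         ≡⟨ m≥n⇒m⊓n≡n (≮⇒≥ M≮V) ⟩
  V             ≡⟨ m≥n⇒m⊓n≡n (≤-trans (≮⇒≥ M≮V) (n≤1+n M)) ⟨
  suc M ⊓ V     ∎
  where open ≡-Reasoning

x-y+y≡x : ∀ x y → (x ℤ.- y) ℤ.+ y ≡ x
x-y+y≡x = ℤ-Solver.solve-∀

[x+y]-x≡y : ∀ x y → (x ℤ.+ y) ℤ.- x ≡ y
[x+y]-x≡y = ℤ-Solver.solve-∀

x-[a+b]≡[x-a]-b : ∀ x a b → x ℤ.- (a ℤ.+ b) ≡ (x ℤ.- a) ℤ.- b
x-[a+b]≡[x-a]-b = ℤ-Solver.solve-∀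

[x-a]-[x-b]≡b-a : ∀ x a b → (x ℤ.- a) ℤ.- (x ℤ.- b) ≡ b ℤ.- a
[x-a]-[x-b]≡b-a = ℤ-Solver.solve-∀

[x-a]-[y-a]≡x-y : ∀ x y a → (x ℤ.- a) ℤ.- (y ℤ.- a) ≡ x ℤ.- y
[x-a]-[y-a]≡x-y = ℤ-Solver.solve-∀

[x-a]-x≡-a : ∀ x a → (x ℤ.- a) ℤ.- x ≡ ℤ.- a
[x-a]-x≡-a = ℤ-Solver.solve-∀

[x-a]+1≡[x+1]-a : ∀ x a → (x ℤ.- a) ℤ.- ℤ.-1ℤ ≡ (x ℤ.+ ℤ.1ℤ) ℤ.- a
[x-a]+1≡[x+1]-a = ℤ-Solver.solve-∀

x-[x+1]≡-1 : ∀ x → x ℤ.- (x ℤ.+ ℤ.1ℤ) ≡ ℤ.-1ℤ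
x-[x+1]≡-1 = ℤ-Solver.solve-∀

pos-suc : ∀ a → + suc a ≡ + a ℤ.+ ℤ.1ℤ
pos-suc a = trans (cong +_ (+-comm 1 a)) (ℤP.pos-+ a 1)

-1-j≡-[1+j] : ∀ j → ℤ.-1ℤ ℤ.- + j ≡ -[1+ j ]
-1-j≡-[1+j] j = trans (ℤP.neg-minus-pos 0 j) (cong -[1+_] (+-identityʳ j))

-- d ∣ℤ x : the natural number d divides the integer x.  This is definitionally
-- the divisibility `+ d ∣ x` of Data.Integer.Divisibility used in Defs.
infix 4 _∣ℤ_
_∣ℤ_ : ℕ → ℤ → Set
d ∣ℤ x = d ∣ ∣ x ∣

∣ℤ-− : ∀ {d x y} → d ∣ℤ x → d ∣ℤ y → d ∣ℤ (x ℤ.- y)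
∣ℤ-− {d} {x} {y} d∣x d∣y = ℤS.∣⇒∣ᵤ (ℤS.∣m∣n⇒∣m-n (ℤS.∣ᵤ⇒∣ {+ d} {x} d∣x) (ℤS.∣ᵤ⇒∣ {+ d} {y} d∣y))

∣ℤ-+ : ∀ {d x y} → d ∣ℤ x → d ∣ℤ y → d ∣ℤ (x ℤ.+ y)
∣ℤ-+ {d} {x} {y} d∣x d∣y = ℤS.∣⇒∣ᵤ (ℤS.∣m∣n⇒∣m+n (ℤS.∣ᵤ⇒∣ {+ d} {x} d∣x) (ℤS.∣ᵤ⇒∣ {+ d} {y} d∣y))

∣ℤ-transfer : ∀ {d x y} → d ∣ℤ (x ℤ.- y) → d ∣ℤ y → d ∣ℤ x
∣ℤ-transfer {d} {x} {y} d∣x-y d∣y = subst (d ∣ℤ_) (x-y+y≡x x y) (∣ℤ-+ {d} {x ℤ.- y} {y} d∣x-y d∣y)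

∣ℤ-flip : ∀ {d} x y → d ∣ℤ (x ℤ.- y) → d ∣ℤ (y ℤ.- x)
∣ℤ-flip {d} x y = subst (d ∣_) (ℤP.∣i-j∣≡∣j-i∣ x y)

close-multiples : ∀ {d n j j'} → j < j' → j' < d → d ∣ℤ (n ℤ.- + j) → ¬ d ∣ℤ (n ℤ.- + j')
close-multiples {d} {n} {j} {j'} j<j' j'<d d∣n-j d∣n-j' =
  >⇒∤ {{>-nonZero (m<n⇒0<n∸m j<j')}} (≤-<-trans (m∸n≤m j' j) j'<d) d∣j'-j
  where
    difference : (n ℤ.- + j) ℤ.- (n ℤ.- + j') ≡ + (j' ∸ j)
    difference = trans ([x-a]-[x-b]≡b-a n (+ j) (+ j')) (trans (ℤP.[+m]-[+n]≡m⊖n j' j) (ℤP.⊖-≥ (<⇒≤ j<j')))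
    d∣j'-j : d ∣ j' ∸ j
    d∣j'-j = subst (d ∣ℤ_) difference (∣ℤ-− {d} {n ℤ.- + j} {n ℤ.- + j'} d∣n-j d∣n-j')

χ : ℕ → ℤ → ℕ
χ d x with d ∣? ∣ x ∣
... | yes _ = 1
... | no  _ = 0

χ-yes : ∀ {d x} → d ∣ℤ x → χ d x ≡ 1
χ-yes {d} {x} d∣x with d ∣? ∣ x ∣
... | yes _   = refl
... | no  d∤x = ⊥-elim (d∤x d∣x)

χ-no : ∀ {d x} → ¬ d ∣ℤ x → χ d x ≡ 0
χ-no {d} {x} d∤x with d ∣? ∣ x ∣
... | yes d∣x = ⊥-elim (d∤x d∣x)
... | no  _   = refl

χ≤1 : ∀ d x → χ d x ≤ 1
χ≤1 d x with d ∣? ∣ x ∣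
... | yes _ = ≤-refl
... | no  _ = z≤n

χ-mod : ∀ {d} x y → d ∣ℤ (x ℤ.- y) → χ d x ≡ χ d y
χ-mod {d} x y d∣x-y with d ∣? ∣ x ∣ | d ∣? ∣ y ∣
... | yes _   | yes _   = refl
... | no  _   | no  _   = refl
... | yes d∣x | no  d∤y = ⊥-elim (d∤y (∣ℤ-transfer {d} {y} {x} (∣ℤ-flip x y d∣x-y) d∣x))
... | no  d∤x | yes d∣y = ⊥-elim (d∤x (∣ℤ-transfer {d} {x} {y} d∣x-y d∣y))

count : ℕ → ℤ → ℕ → ℕ
count d n k = ∑[ j < k ] χ d (n ℤ.- + j)

count-split : ∀ d n a b → count d n (a + b) ≡ count d n a + count d (n ℤ.- + a) b
count-split d n a b = trans (∑-split a b (λ j → χ d (n ℤ.- + j)))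
                            (cong (λ c → count d n a + c) (∑-cong b (λ j _ → cong (χ d) (shift j))))
  where
    shift : ∀ j → n ℤ.- + (a + j) ≡ (n ℤ.- + a) ℤ.- + j
    shift j = trans (cong (λ z → n ℤ.- z) (ℤP.pos-+ a j)) (x-[a+b]≡[x-a]-b n (+ a) (+ j))

-- Any d consecutive integers contain a multiple of d: n - (n mod d).
count-period-≥1 : ∀ d .{{_ : NonZero d}} n → 1 ≤ count d n d
count-period-≥1 d n = subst (_≤ count d n d) (χ-yes {d} {n ℤ.- + r} d∣n-r) (∑-term d (λ j → χ d (n ℤ.- + j)) r r<d)
  where
    r = n ℤDM.%ℕ d
    r<d : r < d
    r<d = ℤDM.n%ℕd<d n d
    n-r≡qd : n ℤ.- + r ≡ (n ℤDM./ℕ d) ℤ.* + d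
    n-r≡qd = begin
      n ℤ.- + r                                   ≡⟨ cong (ℤ._- + r) (ℤDM.a≡a%ℕn+[a/ℕn]*n n d) ⟩
      (+ r ℤ.+ (n ℤDM./ℕ d) ℤ.* + d) ℤ.- + r      ≡⟨ [x+y]-x≡y (+ r) ((n ℤDM./ℕ d) ℤ.* + d) ⟩
      (n ℤDM./ℕ d) ℤ.* + d                        ∎
      where open ≡-Reasoning
    d∣n-r : d ∣ℤ (n ℤ.- + r)
    d∣n-r = subst (d ∣ℤ_) (sym n-r≡qd) (subst (d ∣_) (sym (ℤP.abs-* (n ℤDM./ℕ d) (+ d))) (n∣m*n ∣ n ℤDM./ℕ d ∣))

count-short-≤1 : ∀ d n k → k ≤ d → count d n k ≤ 1
count-short-≤1 d n zero    _      = z≤n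
count-short-≤1 d n (suc k) 1+k≤d with d ∣? ∣ n ℤ.- + k ∣
... | yes d∣n-k = ≤-reflexive (cong (_+ 1) (∑-vanish k (λ j → χ d (n ℤ.- + j))
        (λ j j<k → χ-no {d} {n ℤ.- + j} (λ d∣n-j → close-multiples {d} {n} j<k 1+k≤d d∣n-j d∣n-k))))
... | no  _     = ≤-trans (≤-reflexive (+-identityʳ _)) (count-short-≤1 d n k (≤-trans (n≤1+n k) 1+k≤d))

count-period : ∀ d .{{_ : NonZero d}} n → count d n d ≡ 1
count-period d n = ≤-antisym (count-short-≤1 d n d ≤-refl) (count-period-≥1 d n)

count-blocks : ∀ d .{{_ : NonZero d}} n Q → count d n (Q * d) ≡ Q
count-blocks d n zero    = refl
count-blocks d n (suc Q) = begin
  count d n (d + Q * d)                         ≡⟨ count-split d n d (Q * d) ⟩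
  count d n d + count d (n ℤ.- + d) (Q * d)     ≡⟨ cong₂ _+_ (count-period d n) (count-blocks d (n ℤ.- + d) Q) ⟩
  suc Q                                         ∎
  where open ≡-Reasoning

div-decomposition : ∀ k d .{{_ : NonZero d}} → k ≡ (k / d) * d + k % d
div-decomposition k d = trans (m≡m%n+[m/n]*n k d) (+-comm (k % d) _)

count-lower : ∀ d .{{_ : NonZero d}} n k → k / d ≤ count d n k
count-lower d n k = begin
  k / d                                                          ≡⟨ count-blocks d n (k / d) ⟨
  count d n ((k / d) * d)                                        ≤⟨ m≤m+n _ _ ⟩
  count d n ((k / d) * d) + count d (n ℤ.- + ((k / d) * d)) (k % d) ≡⟨ count-split d n ((k / d) * d) (k % d) ⟨
  count d n ((k / d) * d + k % d)                                ≡⟨ cong (count d n) (div-decomposition k d) ⟨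
  count d n k                                                    ∎
  where open ≤-Reasoning

count-initial : ∀ d r → r < d → count d ℤ.-1ℤ r ≡ 0
count-initial d r r<d = ∑-vanish r (λ j → χ d (ℤ.-1ℤ ℤ.- + j)) (λ j j<r → χ-no {d} {ℤ.-1ℤ ℤ.- + j}
  (λ d∣ → >⇒∤ (≤-trans (s≤s j<r) r<d) (subst (d ∣ℤ_) (-1-j≡-[1+j] j) d∣)))

count-at-minus-one : ∀ d .{{_ : NonZero d}} k → count d ℤ.-1ℤ k ≡ k / d
count-at-minus-one d k = begin
  count d ℤ.-1ℤ k                                          ≡⟨ cong (count d ℤ.-1ℤ) k≡r+Qd ⟩
  count d ℤ.-1ℤ (r + Q * d)                                ≡⟨ count-split d ℤ.-1ℤ r (Q * d) ⟩
  count d ℤ.-1ℤ r + count d (ℤ.-1ℤ ℤ.- + r) (Q * d)        ≡⟨ cong₂ _+_ (count-initial d r (m%n<n k d))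
                                                                        (count-blocks d (ℤ.-1ℤ ℤ.- + r) Q) ⟩
  Q                                                        ∎
  where
    open ≡-Reasoning
    Q = k / d
    r = k % d
    k≡r+Qd : k ≡ r + Q * d
    k≡r+Qd = trans (div-decomposition k d) (+-comm (Q * d) r)

distinct-multiples : ∀ {d n j j'} → ¬ j ≡ j' → j < d → j' < d → d ∣ℤ (n ℤ.- + j) → ¬ d ∣ℤ (n ℤ.- + j')
distinct-multiples {d} {n} {j} {j'} j≢j' j<d j'<d d∣n-j d∣n-j' with <-cmp j j'
... | tri< j<j' _ _ = close-multiples {d} {n} j<j' j'<d d∣n-j d∣n-j'
... | tri≈ _ j≡j' _ = j≢j' j≡j'
... | tri> _ _ j'<j = close-multiples {d} {n} j'<j j<d d∣n-j' d∣n-j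

⊕-mono : ∀ {a b c d} → a ≤∞ b → c ≤∞ d → a ⊕ c ≤∞ b ⊕ d
⊕-mono (fin≤fin a≤b) (fin≤fin c≤d) = fin≤fin (+-mono-≤ a≤b c≤d)
⊕-mono {fin a} (fin≤fin _) (c ≤∞-∞) = (fin a ⊕ c) ≤∞-∞
⊕-mono (a ≤∞-∞) _ = (a ⊕ _) ≤∞-∞

≤∞-trans : ∀ {a b c} → a ≤∞ b → b ≤∞ c → a ≤∞ c
≤∞-trans (fin≤fin a≤b) (fin≤fin b≤c) = fin≤fin (≤-trans a≤b b≤c)
≤∞-trans {a} _ (_ ≤∞-∞) = a ≤∞-∞

fin-≤ : ∀ {a b} → fin a ≤∞ fin b → a ≤ b
fin-≤ (fin≤fin a≤b) = a≤b

⊕-∞ : ∀ a → a ⊕ ∞ ≡ ∞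
⊕-∞ (fin _) = refl
⊕-∞ ∞       = refl

module PAdic (q : ℕ) where

  p : ℕ
  p = suc (suc q)

  pow∣pow : ∀ {t a} → t ≤ a → p ^ t ∣ p ^ a
  pow∣pow {t} {a} t≤a = divides (p ^ (a ∸ t)) (begin
    p ^ a             ≡⟨ cong (p ^_) (m∸n+n≡m t≤a) ⟨
    p ^ (a ∸ t + t)   ≡⟨ ^-distribˡ-+-* p (a ∸ t) t ⟩
    p ^ (a ∸ t) * p ^ t ∎)
    where open ≡-Reasoning

  record IsVal (N a : ℕ) : Set where
    constructor isVal
    field
      unit   : ℕ
      N≡     : N ≡ p ^ a * unit
      p∤unit : ¬ p ∣ unit

  isVal⇒pow∣ : ∀ {N a t} → IsVal N a → t ≤ a → p ^ t ∣ N
  isVal⇒pow∣ {t = t} (isVal u N≡ _) t≤a = subst (p ^ t ∣_) (sym N≡) (∣m⇒∣m*n u (pow∣pow t≤a))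

  pow∣⇒≤val : ∀ {N a t} → IsVal N a → p ^ t ∣ N → t ≤ a
  pow∣⇒≤val {N} {a} {t} (isVal u N≡ p∤u) pᵗ∣N with t ≤? a
  ... | yes t≤a = t≤a
  ... | no  t≰a = ⊥-elim (p∤u (*-cancelˡ-∣ (p ^ a) {{m^n≢0 p a}} pᵃp∣pᵃu))
    where
      pᵃp∣pᵃu : p ^ a * p ∣ p ^ a * u
      pᵃp∣pᵃu = subst₂ _∣_ (*-comm p (p ^ a)) N≡ (∣-trans (pow∣pow (≰⇒> t≰a)) pᵗ∣N)

  isVal-unique : ∀ {N a b} → IsVal N a → IsVal N b → a ≡ b
  isVal-unique va vb = ≤-antisym (pow∣⇒≤val vb (isVal⇒pow∣ va ≤-refl)) (pow∣⇒≤val va (isVal⇒pow∣ vb ≤-refl))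

  isVal-* : Prime p → ∀ {M N a b} → IsVal M a → IsVal N b → IsVal (M * N) (a + b)
  isVal-* p-prime {M} {N} {a} {b} (isVal u M≡ p∤u) (isVal w N≡ p∤w) = isVal (u * w) MN≡ p∤uw
    where
      MN≡ : M * N ≡ p ^ (a + b) * (u * w)
      MN≡ = begin
        M * N                     ≡⟨ cong₂ _*_ M≡ N≡ ⟩
        (p ^ a * u) * (p ^ b * w) ≡⟨ [xy][zw]≡[xz][yw] (p ^ a) u (p ^ b) w ⟩
        (p ^ a * p ^ b) * (u * w) ≡⟨ cong (_* (u * w)) (^-distribˡ-+-* p a b) ⟨
        p ^ (a + b) * (u * w)     ∎
        where
          open ≡-Reasoning
          [xy][zw]≡[xz][yw] : ∀ x y z w → (x * y) * (z * w) ≡ (x * z) * (y * w)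
          [xy][zw]≡[xz][yw] = ℕ-Solver.solve-∀
      p∤uw : ¬ p ∣ u * w
      p∤uw p∣uw with euclidsLemma u w p-prime p∣uw
      ... | inj₁ p∣u = p∤u p∣u
      ... | inj₂ p∣w = p∤w p∣w

  valFuel-isVal : ∀ fuel N → 1 ≤ N → N ≤ fuel → IsVal N (valFuel fuel p N)
  valFuel-isVal zero       N 1≤N N≤0 = ⊥-elim (<⇒≱ 1≤N N≤0)
  valFuel-isVal (suc fuel) N 1≤N N≤fuel with p ∣? N
  ... | no  p∤N = isVal N (sym (*-identityˡ N)) p∤N
  ... | yes (divides m N≡mp) = isVal u N≡ p∤u
    where
      positive : ∀ x → N ≡ x * p → 1 ≤ x
      positive zero    N≡0 = ⊥-elim (<⇒≱ 1≤N (≤-reflexive N≡0))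
      positive (suc _) _   = s≤s z≤n
      1≤m : 1 ≤ m
      1≤m = positive m N≡mp
      m<N : m < N
      m<N = subst (m <_) (sym N≡mp) (m<m*n m p {{>-nonZero 1≤m}} (s≤s (s≤s z≤n)))
      rec : IsVal m (valFuel fuel p m)
      rec = valFuel-isVal fuel m 1≤m (≤-pred (≤-trans m<N N≤fuel))
      open IsVal rec renaming (unit to u; N≡ to m≡; p∤unit to p∤u)
      a = valFuel fuel p m
      N≡ : N ≡ p ^ suc a * u
      N≡ = trans N≡mp (trans (cong (_* p) m≡) (rotate (p ^ a) u p))
        where
          rotate : ∀ x u p → (x * u) * p ≡ (p * x) * u
          rotate = ℕ-Solver.solve-∀

  v : ℕ → ℕ
  v N = valFuel N p N

  v-isVal : ∀ N → 1 ≤ N → IsVal N (v N)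
  v-isVal N 1≤N = valFuel-isVal N N 1≤N ≤-refl

  pow∣⇒≤v : ∀ {N t} → 1 ≤ N → p ^ t ∣ N → t ≤ v N
  pow∣⇒≤v {N} 1≤N = pow∣⇒≤val (v-isVal N 1≤N)

  ≤v⇒pow∣ : ∀ {N t} → 1 ≤ N → t ≤ v N → p ^ t ∣ N
  ≤v⇒pow∣ {N} 1≤N = isVal⇒pow∣ (v-isVal N 1≤N)

  v-* : Prime p → ∀ M N → 1 ≤ M → 1 ≤ N → v (M * N) ≡ v M + v N
  v-* p-prime M N 1≤M 1≤N =
    isVal-unique (v-isVal (M * N) (*-mono-≤ 1≤M 1≤N)) (isVal-* p-prime (v-isVal M 1≤M) (v-isVal N 1≤N))

  v-one : v 1 ≡ 0
  v-one = isVal-unique (v-isVal 1 ≤-refl) (isVal 1 refl (>⇒∤ (s≤s (s≤s z≤n))))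

  v-factorial : Prime p → ∀ n → v (n !) ≡ ∑[ j < n ] v (suc j)
  v-factorial p-prime zero    = v-one
  v-factorial p-prime (suc n) = begin
    v (suc n * n !)           ≡⟨ v-* p-prime (suc n) (n !) (s≤s z≤n) (1≤n! n) ⟩
    v (suc n) + v (n !)       ≡⟨ +-comm (v (suc n)) (v (n !)) ⟩
    v (n !) + v (suc n)       ≡⟨ cong (_+ v (suc n)) (v-factorial p-prime n) ⟩
    ∑[ j < suc n ] v (suc j)  ∎
    where open ≡-Reasoning

  infixl 7 _/p^_
  _/p^_ : ℕ → ℕ → ℕ
  k /p^ t = _/_ k (p ^ t) {{m^n≢0 p t}}

  /p^-step : ∀ k s → k /p^ suc s ≡ (k /p^ s) / p
  /p^-step k s = sym (trans (m/n/o≡m/[n*o] k (p ^ s) p {{m^n≢0 p s}} {{_}} {{pˢp≢0}})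
                            (/-congʳ {{pˢp≢0}} {{m^n≢0 p (suc s)}} (*-comm (p ^ s) p)))
    where
      pˢp≢0 : NonZero (p ^ s * p)
      pˢp≢0 = m*n≢0 (p ^ s) p {{m^n≢0 p s}}

  digit-identity : ∀ k L → suc q * ∑[ s < L ] (k /p^ suc s) + k /p^ L + ∑[ s < L ] ((k /p^ s) % p) ≡ k
  digit-identity k zero = trans (cong (λ a → a + k /p^ 0 + 0) (*-zeroʳ q)) (trans (+-identityʳ _) (n/1≡n k))
  digit-identity k (suc L) = begin
    suc q * (A + x) + x + (R + y)  ≡⟨ regroup q A x R y ⟩
    suc q * A + (y + x * p) + R    ≡⟨ cong (λ z → suc q * A + (y + z * p) + R) (/p^-step k L) ⟩
    suc q * A + (y + (k /p^ L) / p * p) + R ≡⟨ cong (λ z → suc q * A + z + R) (m≡m%n+[m/n]*n (k /p^ L) p) ⟨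
    suc q * A + k /p^ L + R        ≡⟨ digit-identity k L ⟩
    k                              ∎
    where
      open ≡-Reasoning
      A = ∑[ s < L ] (k /p^ suc s)
      R = ∑[ s < L ] ((k /p^ s) % p)
      x = k /p^ suc L
      y = (k /p^ L) % p
      regroup : ∀ q A x R y → suc q * (A + x) + x + (R + y) ≡ suc q * A + (y + x * suc (suc q)) + R
      regroup = ℕ-Solver.solve-∀

module Truncation (q : ℕ) where
  open PAdic q public

  -- τ M x = min (M , ν_p x): the number of levels s < M with p ^ (s + 1) ∣ x.
  -- Unlike ν_p it is finite at 0 and depends only on x modulo p ^ M.
  τ : ℕ → ℤ → ℕ
  τ M x = ∑[ s < M ] χ (p ^ suc s) x

  τ-nonzero : ∀ M x → 1 ≤ ∣ x ∣ → τ M x ≡ M ⊓ v ∣ x ∣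
  τ-nonzero M x 1≤∣x∣ = ∑-threshold M (v ∣ x ∣) (λ s → χ (p ^ suc s) x)
    (λ s s<v → χ-yes {p ^ suc s} {x} (≤v⇒pow∣ 1≤∣x∣ s<v))
    (λ s v≤s → χ-no {p ^ suc s} {x} (λ p^s+1∣x → <⇒≱ (s≤s v≤s) (pow∣⇒≤v 1≤∣x∣ p^s+1∣x)))

  τ-mod : ∀ M x y → p ^ M ∣ℤ (x ℤ.- y) → τ M x ≡ τ M y
  τ-mod M x y pᴹ∣x-y = ∑-cong M (λ s s<M → χ-mod x y (∣-trans (pow∣pow s<M) pᴹ∣x-y))

  ν-positive : ∀ N → 1 ≤ N → ν p (+ N) ≡ fin (v N)
  ν-positive (suc n) _ = refl

  τ≤ν : ∀ M x → fin (τ M x) ≤∞ ν p x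
  τ≤ν M (+ zero)  = fin _ ≤∞-∞
  τ≤ν M (+ suc n) = fin≤fin (subst (_≤ v (suc n)) (sym (τ-nonzero M (+ suc n) (s≤s z≤n))) (m⊓n≤n M _))
  τ≤ν M -[1+ n ]  = fin≤fin (subst (_≤ v (suc n)) (sym (τ-nonzero M -[1+ n ] (s≤s z≤n))) (m⊓n≤n M _))

  v≡M⊓v : ∀ M N → 1 ≤ N → ¬ p ^ suc M ∣ N → v N ≡ M ⊓ v N
  v≡M⊓v M N 1≤N p^M+1∤N with suc M ≤? v N
  ... | yes M<v = ⊥-elim (p^M+1∤N (≤v⇒pow∣ 1≤N M<v))
  ... | no  M≮v = sym (m≥n⇒m⊓n≡n (≤-pred (≰⇒> M≮v)))

  ν≡τ : ∀ M x → ¬ p ^ suc M ∣ℤ x → ν p x ≡ fin (τ M x)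
  ν≡τ M (+ zero)  p^M+1∤0 = ⊥-elim (p^M+1∤0 (_ ∣0))
  ν≡τ M (+ suc n) p^M+1∤x =
    cong fin (trans (v≡M⊓v M (suc n) (s≤s z≤n) p^M+1∤x) (sym (τ-nonzero M (+ suc n) (s≤s z≤n))))
  ν≡τ M -[1+ n ]  p^M+1∤x =
    cong fin (trans (v≡M⊓v M (suc n) (s≤s z≤n) p^M+1∤x) (sym (τ-nonzero M -[1+ n ] (s≤s z≤n))))

  band : ℕ → ℕ → ℤ → ℕ
  band L d x = ∑[ s < d ] χ (p ^ suc (L + s)) x

  τ-split : ∀ L d x → τ (L + d) x ≡ τ L x + band L d x
  τ-split L d x = ∑-split L d (λ s → χ (p ^ suc s) x)

  band-full : ∀ L d x → p ^ (L + d) ∣ℤ x → band L d x ≡ d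
  band-full L d x pᴸ⁺ᵈ∣x = ∑-ones d (λ s → χ (p ^ suc (L + s)) x)
    (λ s s<d → χ-yes {p ^ suc (L + s)} {x}
                 (∣-trans (pow∣pow (subst (_≤ L + d) (+-suc L s) (+-monoʳ-≤ L s<d))) pᴸ⁺ᵈ∣x))

  band-empty : ∀ L d x → ¬ p ^ suc L ∣ℤ x → band L d x ≡ 0
  band-empty L d x p^L+1∤x = ∑-vanish d (λ s → χ (p ^ suc (L + s)) x)
    (λ s _ → χ-no {p ^ suc (L + s)} {x}
               (λ p^L+s+1∣x → p^L+1∤x (∣-trans (pow∣pow (s≤s (m≤m+n L s))) p^L+s+1∣x)))

  band-short : ∀ L d x → ¬ p ^ suc (L + d) ∣ℤ x → band L (suc d) x ≤ d
  band-short L d x p^L+d+1∤x = begin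
    band L d x + χ (p ^ suc (L + d)) x ≡⟨ cong (_+_ (band L d x)) (χ-no {p ^ suc (L + d)} {x} p^L+d+1∤x) ⟩
    band L d x + 0                     ≡⟨ +-identityʳ _ ⟩
    band L d x                         ≤⟨ ∑-bound d (λ s → χ (p ^ suc (L + s)) x) 1 (λ s _ → χ≤1 (p ^ suc (L + s)) x) ⟩
    d * 1                              ≡⟨ *-identityʳ d ⟩
    d                                  ∎
    where open ≤-Reasoning

  W : ℕ → ℕ → ℤ → ℕ
  W k M n = ∑[ j < k ] τ M (n ℤ.- + j)

  W≤f : ∀ k M n → fin (W k M n) ≤∞ f p k n
  W≤f zero    M n = fin≤fin z≤n
  W≤f (suc k) M n = ⊕-mono (W≤f k M n) (τ≤ν M (n ℤ.- + k))

  f≡W : ∀ k M n → (∀ j → j < k → ¬ p ^ suc M ∣ℤ (n ℤ.- + j)) → f p k n ≡ fin (W k M n)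
  f≡W zero    M n _    = refl
  f≡W (suc k) M n p∤all = cong₂ _⊕_ (f≡W k M n (λ j j<k → p∤all j (m<n⇒m<1+n j<k)))
                                    (ν≡τ M (n ℤ.- + k) (p∤all k ≤-refl))

  f-∞ : ∀ k n j₀ → j₀ < k → n ℤ.- + j₀ ≡ + 0 → f p k n ≡ ∞
  f-∞ (suc k) n j₀ j₀<1+k n-j₀≡0 with j₀ ≟ k
  ... | yes refl = trans (cong (λ x → f p k n ⊕ ν p x) n-j₀≡0) (⊕-∞ (f p k n))
  ... | no  j₀≢k = cong (_⊕ ν p (n ℤ.- + k)) (f-∞ k n j₀ (≤∧≢⇒< (≤-pred j₀<1+k) j₀≢k) n-j₀≡0)

  W-mod : ∀ k M n n′ → p ^ M ∣ℤ (n ℤ.- n′) → W k M n ≡ W k M n′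
  W-mod k M n n′ pᴹ∣n-n′ = ∑-cong k (λ j _ →
    τ-mod M (n ℤ.- + j) (n′ ℤ.- + j) (subst (p ^ M ∣ℤ_) (sym ([x-a]-[y-a]≡x-y n n′ (+ j))) pᴹ∣n-n′))

  W-counts : ∀ k M n → W k M n ≡ ∑[ s < M ] count (p ^ suc s) n k
  W-counts k M n = ∑-swap k M (λ j s → χ (p ^ suc s) (n ℤ.- + j))

  -- Hence W k M is smallest on the window -1, …, -k, where it is a Legendre sum.
  W-lower : ∀ k M n → ∑[ s < M ] (k /p^ suc s) ≤ W k M n
  W-lower k M n = subst (_ ≤_) (sym (W-counts k M n))
    (∑-mono M (λ s _ → count-lower (p ^ suc s) {{m^n≢0 p (suc s)}} n k))

  W-minus-one : ∀ k M → W k M ℤ.-1ℤ ≡ ∑[ s < M ] (k /p^ suc s)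
  W-minus-one k M = trans (W-counts k M ℤ.-1ℤ)
    (∑-cong M (λ s _ → count-at-minus-one (p ^ suc s) {{m^n≢0 p (suc s)}} k))

  W-split : ∀ k L d n → W k (L + d) n ≡ W k L n + ∑[ j < k ] band L d (n ℤ.- + j)
  W-split k L d n = trans (∑-cong k (λ j _ → τ-split L d (n ℤ.- + j)))
                          (∑-distrib-+ k (λ j → τ L (n ℤ.- + j)) (λ j → band L d (n ℤ.- + j)))

module Legendre (q : ℕ) (p-prime : Prime (suc (suc q))) (k L : ℕ)
                (pᴸ≤k : suc (suc q) ^ L ≤ k) (k<pᴸ⁺¹ : k < suc (suc q) ^ suc L) where
  open Truncation q public

  E : ℕ
  E = v (k !)

  e≡E : e p k ≡ fin E
  e≡E = ν-positive (k !) (1≤n! k)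

  v-bounded : ∀ i → 1 ≤ i → i ≤ k → v i ≤ L
  v-bounded i 1≤i i≤k with v i ≤? L
  ... | yes v≤L = v≤L
  ... | no  v≰L = ⊥-elim (<⇒≱ k<pᴸ⁺¹ (begin
    p ^ suc L  ≤⟨ ^-monoʳ-≤ p (≰⇒> v≰L) ⟩
    p ^ v i    ≤⟨ ∣⇒≤ {{>-nonZero 1≤i}} (≤v⇒pow∣ 1≤i ≤-refl) ⟩
    i          ≤⟨ i≤k ⟩
    k          ∎))
    where open ≤-Reasoning

  E≡W-1 : E ≡ W k L ℤ.-1ℤ
  E≡W-1 = trans (v-factorial p-prime k) (∑-cong k (λ j j<k → sym (τ-at j j<k)))
    where
      τ-at : ∀ j → j < k → τ L (ℤ.-1ℤ ℤ.- + j) ≡ v (suc j)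
      τ-at j j<k = trans (cong (τ L) (-1-j≡-[1+j] j))
                         (trans (τ-nonzero L -[1+ j ] (s≤s z≤n)) (m≥n⇒m⊓n≡n (v-bounded (suc j) (s≤s z≤n) j<k)))

  legendre : E ≡ ∑[ s < L ] (k /p^ suc s)
  legendre = trans E≡W-1 (W-minus-one k L)

  E≤W : ∀ n → E ≤ W k L n
  E≤W n = subst (_≤ W k L n) (sym legendre) (W-lower k L n)

module ValueOfA (q : ℕ) (p-prime : Prime (suc (suc q))) (k L : ℕ)
                (pᴸ≤k : suc (suc q) ^ L ≤ k) (k<pᴸ⁺¹ : k < suc (suc q) ^ suc L) where
  open Legendre q p-prime k L pᴸ≤k k<pᴸ⁺¹ public

  m : ℕ
  m = L + E

  Cond⇐ : ∀ n → E + E ≤ W k m n → Cond p k n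
  Cond⇐ n 2E≤W = subst (λ x → x ⊕ x ≤∞ f p k n) (sym e≡E) (≤∞-trans (fin≤fin 2E≤W) (W≤f k m n))

  -- If p ^ m divides some n - j₀ of the window, then the first L levels
  -- contribute at least E and the levels above L of n - j₀ alone another E.
  deep-window : ∀ n j₀ → j₀ < k → p ^ m ∣ℤ (n ℤ.- + j₀) → E + E ≤ W k m n
  deep-window n j₀ j₀<k pᵐ∣n-j₀ = begin
    E + E                                    ≤⟨ +-mono-≤ (E≤W n) (≤-reflexive (sym (band-full L E (n ℤ.- + j₀) pᵐ∣n-j₀))) ⟩
    W k L n + band L E (n ℤ.- + j₀)          ≤⟨ +-monoʳ-≤ (W k L n) (∑-term k (λ j → band L E (n ℤ.- + j)) j₀ j₀<k) ⟩
    W k L n + ∑[ j < k ] band L E (n ℤ.- + j) ≡⟨ W-split k L E n ⟨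
    W k m n                                  ∎
    where open ≤-Reasoning

  -- Conversely, either some n - j₀ is divisible by p ^ (m + 1), or no valuation
  -- in the window exceeds m and f_{p,k}(n) = W k m n.
  Cond⇒ : ∀ n → Cond p k n → E + E ≤ W k m n
  Cond⇒ n cond with anyUpTo? (λ j → p ^ suc m ∣? ∣ n ℤ.- + j ∣) k
  ... | yes (j₀ , j₀<k , p^m+1∣) = deep-window n j₀ j₀<k (∣-trans (pow∣pow (n≤1+n m)) p^m+1∣)
  ... | no  none = fin-≤ (subst (fin (E + E) ≤∞_) (f≡W k m n (λ j j<k p^m+1∣ → none (j , j<k , p^m+1∣)))
                                (subst (λ x → x ⊕ x ≤∞ f p k n) e≡E cond))

  depends : DependsOnlyMod p k m
  depends n n′ pᵐ∣n-n′ = mk⇔ (transfer n n′ W≡) (transfer n′ n (sym W≡))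
    where
      W≡ : W k m n ≡ W k m n′
      W≡ = W-mod k m n n′ pᵐ∣n-n′
      transfer : ∀ x y → W k m x ≡ W k m y → Cond p k x → Cond p k y
      transfer x y W≡ cond = Cond⇐ y (subst (E + E ≤_) W≡ (Cond⇒ x cond))

  -- j₀ = p ^ L - 1 < k; the window of n′ = j₀ contains 0, so Cond p k j₀ holds.
  j₀ : ℕ
  j₀ = p ^ L ∸ 1

  1+j₀≡pᴸ : suc j₀ ≡ p ^ L
  1+j₀≡pᴸ = trans (+-comm 1 j₀) (m∸n+n≡m (m^n>0 p L))

  j₀<k : j₀ < k
  j₀<k = subst (_≤ k) (sym 1+j₀≡pᴸ) pᴸ≤k

  cond-at-j₀ : Cond p k (+ j₀)
  cond-at-j₀ = subst (e p k ⊕ e p k ≤∞_) (sym (f-∞ k (+ j₀) j₀ j₀<k (ℤP.+-inverseʳ (+ j₀)))) (_ ≤∞-∞)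

  -- Write E = E′ + 1 and n = j₀ - p ^ (L + E′).  Modulo p ^ L the window of n is
  -- that of -1, and only n - j₀ = -p ^ (L + E′) is divisible by p ^ (L + 1), with
  -- valuation L + E′; hence W k m n ≤ E + E′ < 2E and Cond p k n fails, although
  -- n ≡ j₀ modulo p ^ (L + E′).
  module Shifted (E′ : ℕ) (E≡ : E ≡ suc E′) where
    P : ℕ
    P = p ^ (L + E′)

    n : ℤ
    n = + j₀ ℤ.- + P

    n-j₀≡-P : n ℤ.- + j₀ ≡ ℤ.- + P
    n-j₀≡-P = [x-a]-x≡-a (+ j₀) (+ P)

    W-L-at-n : W k L n ≡ E
    W-L-at-n = trans (W-mod k L n ℤ.-1ℤ pᴸ∣n+1) (sym E≡W-1)
      where
        n+1≡pᴸ-P : n ℤ.- ℤ.-1ℤ ≡ + (p ^ L) ℤ.- + P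
        n+1≡pᴸ-P = trans ([x-a]+1≡[x+1]-a (+ j₀) (+ P))
          (cong (ℤ._- + P) (trans (sym (pos-suc j₀)) (cong +_ 1+j₀≡pᴸ)))
        pᴸ∣n+1 : p ^ L ∣ℤ (n ℤ.- ℤ.-1ℤ)
        pᴸ∣n+1 = subst (p ^ L ∣ℤ_) (sym n+1≡pᴸ-P) (∣ℤ-− {p ^ L} {+ (p ^ L)} {+ P} ∣-refl (pow∣pow (m≤m+n L E′)))

    p^t∣n-j₀ : ∀ {t} → t ≤ L + E′ → p ^ t ∣ℤ (n ℤ.- + j₀)
    p^t∣n-j₀ {t} t≤ = subst (p ^ t ∣ℤ_) (sym n-j₀≡-P) (subst (p ^ t ∣_) (sym (ℤP.∣-i∣≡∣i∣ (+ P))) (pow∣pow t≤))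

    -- For j ≠ j₀ the number n - j is not divisible by p ^ (L + 1): if E′ = 0 then
    -- n = -1 and 1 ≤ |n - j| ≤ k; otherwise p ^ (L + 1) already divides n - j₀.
    only-j₀-deep : ∀ j → j < k → ¬ j ≡ j₀ → ¬ p ^ suc L ∣ℤ (n ℤ.- + j)
    only-j₀-deep j j<k j≢j₀ with E′ ≟ 0
    ... | yes E′≡0 = λ p^L+1∣ → >⇒∤ (≤-<-trans j<k k<pᴸ⁺¹) (subst (p ^ suc L ∣ℤ_) n-j≡-[1+j] p^L+1∣)
      where
        n≡-1 : n ≡ ℤ.-1ℤ
        n≡-1 = begin
          + j₀ ℤ.- + P                   ≡⟨ cong (λ e → + j₀ ℤ.- + (p ^ e)) (trans (cong (_+_ L) E′≡0) (+-identityʳ L)) ⟩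
          + j₀ ℤ.- + (p ^ L)             ≡⟨ cong (λ x → + j₀ ℤ.- + x) (sym 1+j₀≡pᴸ) ⟩
          + j₀ ℤ.- + suc j₀              ≡⟨ cong (λ x → + j₀ ℤ.- x) (pos-suc j₀) ⟩
          + j₀ ℤ.- (+ j₀ ℤ.+ ℤ.1ℤ)       ≡⟨ x-[x+1]≡-1 (+ j₀) ⟩
          ℤ.-1ℤ                       ∎
          where open ≡-Reasoning
        n-j≡-[1+j] : n ℤ.- + j ≡ -[1+ j ]
        n-j≡-[1+j] = trans (cong (ℤ._- + j) n≡-1) (-1-j≡-[1+j] j)
    ... | no  E′≢0 = distinct-multiples {p ^ suc L} {n} (λ j₀≡j → j≢j₀ (sym j₀≡j)) (<-trans j₀<k k<pᴸ⁺¹)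
                       (<-trans j<k k<pᴸ⁺¹) (p^t∣n-j₀ L+1≤L+E′)
      where
        L+1≤L+E′ : suc L ≤ L + E′
        L+1≤L+E′ = subst (_≤ L + E′) (+-comm L 1) (+-monoʳ-≤ L (n≢0⇒n>0 E′≢0))

    -- n - j₀ = -P has valuation exactly L + E′, so it lies in only E′ of the E levels above L.
    band-at-j₀ : band L E (n ℤ.- + j₀) ≤ E′
    band-at-j₀ = subst (λ e → band L e (n ℤ.- + j₀) ≤ E′) (sym E≡) (band-short L E′ (n ℤ.- + j₀) p^L+E′+1∤)
      where
        p^L+E′+1∤ : ¬ p ^ suc (L + E′) ∣ℤ (n ℤ.- + j₀)
        p^L+E′+1∤ d = >⇒∤ {{m^n≢0 p (L + E′)}} (^-monoʳ-< p (s≤s (s≤s z≤n)) (n<1+n (L + E′)))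
                        (subst (p ^ suc (L + E′) ∣_) (ℤP.∣-i∣≡∣i∣ (+ P)) (subst (p ^ suc (L + E′) ∣ℤ_) n-j₀≡-P d))

    W-bound : W k m n ≤ E + E′
    W-bound = begin
      W k m n                                   ≡⟨ W-split k L E n ⟩
      W k L n + ∑[ j < k ] band L E (n ℤ.- + j)  ≡⟨ cong₂ _+_ W-L-at-n (∑-single k (λ j → band L E (n ℤ.- + j)) j₀ j₀<k
                                                     (λ j j<k j≢j₀ → band-empty L E (n ℤ.- + j) (only-j₀-deep j j<k j≢j₀))) ⟩
      E + band L E (n ℤ.- + j₀)                  ≤⟨ +-monoʳ-≤ E band-at-j₀ ⟩
      E + E′                                    ∎
      where open ≤-Reasoning

    cond-fails : ¬ Cond p k n
    cond-fails cond = <⇒≱ (+-monoʳ-< E (subst (E′ <_) (sym E≡) ≤-refl)) (≤-trans (Cond⇒ n cond) W-bound)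

  -- p ≤ k gives p ∣ k!, i.e. E ≥ 1.
  E≥1 : p ≤ k → 1 ≤ E
  E≥1 p≤k = subst (1 ≤_) (sym (v-factorial p-prime k)) (≤-trans v[p]≥1 (∑-term k (λ j → v (suc j)) (suc q) p≤k))
    where
      v[p]≥1 : 1 ≤ v p
      v[p]≥1 = pow∣⇒≤v (s≤s z≤n) (∣-reflexive (*-identityʳ p))

  -- No smaller modulus works: for m′ < m the points n and j₀ above agree modulo
  -- p ^ m′ but differ on Cond.
  minimal : p ≤ k → ∀ m′ → DependsOnlyMod p k m′ → m ≤ m′
  minimal p≤k m′ dep with m ≤? m′
  ... | yes m≤m′ = m≤m′
  ... | no  m≰m′ = ⊥-elim (cond-fails (Equivalence.from (dep n (+ j₀) (p^t∣n-j₀ m′≤)) cond-at-j₀))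
    where
      E≡ : E ≡ suc (E ∸ 1)
      E≡ = sym (trans (+-comm 1 (E ∸ 1)) (m∸n+n≡m (E≥1 p≤k)))
      open Shifted (E ∸ 1) E≡
      m′≤ : m′ ≤ L + (E ∸ 1)
      m′≤ = ≤-pred (subst (m′ <_) (trans (cong (_+_ L) E≡) (+-suc L (E ∸ 1))) (≰⇒> m≰m′))

module DigitBounds (q : ℕ) (p-prime : Prime (suc (suc q))) (k L : ℕ)
                   (pᴸ≤k : suc (suc q) ^ L ≤ k) (k<pᴸ⁺¹ : k < suc (suc q) ^ suc L) where
  open Legendre q p-prime k L pᴸ≤k k<pᴸ⁺¹ public

  -- k = (p - 1) E + s_p(k), where the digit sum s_p(k) consists of the leading
  -- digit ⌊k / p^L⌋ ∈ [1, p - 1] and L further digits in [0, p - 1].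
  digit-sum : suc q * E + k /p^ L + ∑[ s < L ] ((k /p^ s) % p) ≡ k
  digit-sum = trans (cong (λ x → suc q * x + k /p^ L + ∑[ s < L ] ((k /p^ s) % p)) legendre) (digit-identity k L)

  leading-digit≥1 : 1 ≤ k /p^ L
  leading-digit≥1 = m≥n⇒m/n>0 {{m^n≢0 p L}} pᴸ≤k

  leading-digit<p : k /p^ L < p
  leading-digit<p = m<n*o⇒m/o<n {{m^n≢0 p L}} k<pᴸ⁺¹

  lower-digits≤ : ∑[ s < L ] ((k /p^ s) % p) ≤ L * suc q
  lower-digits≤ = ∑-bound L (λ s → (k /p^ s) % p) (suc q) (λ s _ → ≤-pred (m%n<n (k /p^ s) p))

  [p-1]E<k : suc q * E + 1 ≤ k
  [p-1]E<k = begin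
    suc q * E + 1                                         ≤⟨ +-monoʳ-≤ (suc q * E) leading-digit≥1 ⟩
    suc q * E + k /p^ L                                   ≤⟨ m≤m+n _ _ ⟩
    suc q * E + k /p^ L + ∑[ s < L ] ((k /p^ s) % p)      ≡⟨ digit-sum ⟩
    k                                                     ∎
    where open ≤-Reasoning

  k<[m+2][p-1] : k < (L + E + 2) * suc q
  k<[m+2][p-1] = begin-strict
    k                                                     ≡⟨ digit-sum ⟨
    suc q * E + k /p^ L + ∑[ s < L ] ((k /p^ s) % p)      ≤⟨ +-mono-≤ (+-monoʳ-≤ (suc q * E) (≤-pred leading-digit<p)) lower-digits≤ ⟩
    suc q * E + suc q + L * suc q                         <⟨ +-monoˡ-< (L * suc q) (+-monoʳ-< (suc q * E) (m<m+n (suc q) (s≤s z≤n))) ⟩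
    suc q * E + (suc q + suc q) + L * suc q               ≡⟨ regroup q E L ⟩
    (L + E + 2) * suc q                                   ∎
    where
      open ≤-Reasoning
      regroup : ∀ q E L → suc q * E + (suc q + suc q) + L * suc q ≡ (L + E + 2) * suc q
      regroup = ℕ-Solver.solve-∀

  p^m[p-1]≤ : p ^ ((L + E) * suc q) ≤ k ^ suc q * p ^ k
  p^m[p-1]≤ = begin
    p ^ ((L + E) * suc q)                       ≡⟨ cong (p ^_) (*-distribʳ-+ (suc q) L E) ⟩
    p ^ (L * suc q + E * suc q)                 ≡⟨ ^-distribˡ-+-* p (L * suc q) (E * suc q) ⟩
    p ^ (L * suc q) * p ^ (E * suc q)           ≡⟨ cong (_* p ^ (E * suc q)) (^-*-assoc p L (suc q)) ⟨
    (p ^ L) ^ suc q * p ^ (E * suc q)           ≤⟨ *-mono-≤ (^-monoˡ-≤ (suc q) pᴸ≤k) (^-monoʳ-≤ p E[p-1]≤k) ⟩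
    k ^ suc q * p ^ k                           ∎
    where
      open ≤-Reasoning
      E[p-1]≤k : E * suc q ≤ k
      E[p-1]≤k = subst (_≤ k) (*-comm (suc q) E) (≤-trans (m≤m+n (suc q * E) 1) [p-1]E<k)

n<p^n : ∀ q n → n < suc (suc q) ^ n
n<p^n q zero    = s≤s z≤n
n<p^n q (suc n) = begin-strict
  suc n                            <⟨ s≤s (n<p^n q n) ⟩
  suc (pⁿ)                         ≤⟨ +-monoˡ-≤ pⁿ (m^n>0 (suc (suc q)) n) ⟩
  pⁿ + pⁿ                          ≤⟨ +-monoʳ-≤ pⁿ (m≤m+n pⁿ (q * pⁿ)) ⟩
  suc (suc q) ^ suc n              ∎
  where
    open ≤-Reasoning
    pⁿ = suc (suc q) ^ n

floor-log : ∀ q k B → 1 ≤ k → k < suc (suc q) ^ B → Σ ℕ (λ L → suc (suc q) ^ L ≤ k × k < suc (suc q) ^ suc L)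
floor-log q k zero    1≤k k<1  = ⊥-elim (<⇒≱ k<1 1≤k)
floor-log q k (suc B) 1≤k k<pᴮ⁺¹ with k <? suc (suc q) ^ B
... | yes k<pᴮ = floor-log q k B 1≤k k<pᴮ
... | no  k≮pᴮ = B , ≮⇒≥ k≮pᴮ , k<pᴮ⁺¹

corollary1 : ∀ (k p : ℕ) → 2 ≤ k → Prime p → p ≤ k →
    Σ ℕ (λ m → IsA p k m
    × k < (m + 2) * (p ∸ 1)
    × p ^ (m * (p ∸ 1)) ≤ k ^ (p ∸ 1) * p ^ k)
corollary1 k zero          _   p-prime _   = ⊥-elim (¬prime[0] p-prime)
corollary1 k (suc zero)    _   p-prime _   = ⊥-elim (¬prime[1] p-prime)
corollary1 k (suc (suc q)) 2≤k p-prime p≤k with floor-log q k k (≤-trans (s≤s z≤n) 2≤k) (n<p^n q k)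
... | L , pᴸ≤k , k<pᴸ⁺¹ = m , (depends , minimal p≤k) , k<[m+2][p-1] , p^m[p-1]≤
  where
    open ValueOfA q p-prime k L pᴸ≤k k<pᴸ⁺¹
    open DigitBounds q p-prime k L pᴸ≤k k<pᴸ⁺¹
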